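{- Let $n$ be an odd positive integer and $p\ge1$, and let $M\in\mathcal M_{n,p}$ be lexicographically ordered. Then $M$ has block form.
   Context: $\mathcal M_{n,p}$ is the set of $p\times p$ real symmetric positive definite matrices whose diagonal entries all equal $n$ and whose entries are integers congruent to $n$ modulo $4$. An entry of such a matrix is minimal if its absolute value is the smallest allowed, i.e. it equals $1$ if $n\equiv1\pmod 4$ and $-1$ if $n\equiv 3\pmod 4$. A set of indices $A\subseteq\{1,\ldots,p\}$ is a block of $M$ if $M_{i,j}$ is minimal for every $i\in A$, $j\notin A$, and no proper nonempty subset of $A$ has this property. A set $A$ of indices is contiguous if $i,k\in A$ and $i<j<k$ imply $j\in A$. $M$ has block form if all its blocks are contiguous. For integers $a,b$ write $a<_{a}b$ if $|a|<|b|$; for integer vectors, $u<_a v$ means $u$ is lexicographically smaller than $v$ when individual entries are compared via $<_a$ (i.e. by absolute value). $M$ is lexicographically ordered if its rows are in descending lexicographic order with respect to this ordering $<_a$. -}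

module Defs where

open import Data.Nat as ℕ using (ℕ; suc)
open import Data.Nat.DivMod using (_%_)
open import Data.Integer as ℤ using (ℤ; +_; -_; ∣_∣; _*_; _+_; _-_)
open import Data.Integer.Divisibility using () renaming (_∣_ to _∣ℤ_)
open import Data.Fin using (Fin)
open import Data.Fin.Subset using (Subset; _∈_; _∉_; _⊂_; Nonempty)
open import Data.Product using (_×_; Σ; ∃)
open import Data.Sum using (_⊎_)
open import Relation.Binary.PropositionalEquality using (_≡_)
open import Relation.Nullary using (¬_)

Matrix : ℕ → Set
Matrix p = Fin p → Fin p → ℤ

Σᶠ : ∀ {p} → (Fin p → ℤ) → ℤ
Σᶠ {ℕ.zero} f = + 0
Σᶠ {suc p} f = f Fin.zero + Σᶠ (λ i → f (Fin.suc i))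
  where import Data.Fin as Fin

Symmetric : ∀ {p} → Matrix p → Set
Symmetric M = ∀ i j → M i j ≡ M j i

quadForm : ∀ {p} → Matrix p → (Fin p → ℤ) → ℤ
quadForm M x = Σᶠ (λ i → Σᶠ (λ j → x i * M i j * x j))

-- positive definite (tested on nonzero integer vectors; equivalent to the
-- real notion for integer matrices)
PositiveDefinite : ∀ {p} → Matrix p → Set
PositiveDefinite {p} M = (x : Fin p → ℤ) → ¬ (∀ i → x i ≡ + 0) → + 0 ℤ.< quadForm M x

InM : (n p : ℕ) → Matrix p → Set
InM n p M = Symmetric M × PositiveDefinite M
          × (∀ i → M i i ≡ + n)
          × (∀ i j → (+ 4) ∣ℤ (M i j - + n))

minVal : ℕ → ℤ
minVal n with n % 4
... | 1 = + 1
... | _ = - (+ 1)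

Minimal : ℕ → ℤ → Set
Minimal n x = x ≡ minVal n

Separated : ∀ {p} → ℕ → Matrix p → Subset p → Set
Separated n M A = ∀ i j → i ∈ A → j ∉ A → Minimal n (M i j)

IsBlock : ∀ {p} → ℕ → Matrix p → Subset p → Set
IsBlock n M A = Nonempty A × Separated n M A
              × (∀ B → B ⊂ A → Nonempty B → ¬ Separated n M B)

Contiguous : ∀ {p} → Subset p → Set
Contiguous A = ∀ i j k → i ∈ A → k ∈ A → i Data.Fin.< j → j Data.Fin.< k → j ∈ A
  where import Data.Fin

BlockForm : ∀ {p} → ℕ → Matrix p → Set
BlockForm n M = ∀ A → IsBlock n M A → Contiguous A

_<ₐ_ : ∀ {p} → (Fin p → ℤ) → (Fin p → ℤ) → Set
_<ₐ_ {p} u v = ∃ λ (k : Fin p) → (∀ i → i Data.Fin.< k → ∣ u i ∣ ≡ ∣ v i ∣) × (∣ u k ∣ ℕ.< ∣ v k ∣)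
  where import Data.Fin

_≈ₐ_ : ∀ {p} → (Fin p → ℤ) → (Fin p → ℤ) → Set
u ≈ₐ v = ∀ i → ∣ u i ∣ ≡ ∣ v i ∣

LexOrdered : ∀ {p} → Matrix p → Set
LexOrdered M = ∀ i j → i Data.Fin.< j → (M j <ₐ M i) ⊎ (M j ≈ₐ M i)
  where import Data.Fin

{-# OPTIONS --safe #-}
-- Entries of M are congruent to the odd number n modulo 4, so they are nonzero and an entry
-- is minimal exactly when it is ±1.  Call c a cut if M r t = ±1 whenever t < c ≤ r.  As 1 is
-- the least absolute value, a row whose first x entries are ±1 can only be followed, in
-- lexicographic order, by rows with the same property; so if row x is ±1 before the
-- diagonal, x is a cut.  Colour the positions by membership in a block A.  Where the colour
-- changes, at x say, the columns before x lie either before the cut starting the previous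
-- monochromatic run or in that run, which has the other colour; so by induction every run
-- starts at a cut.  A gap j in A between members i < j < k then yields a cut c with
-- i < c ≤ j < k, and A ∩ [0, c) is a smaller separated set.
module Submission where

open import Defs
open import Data.Bool using () renaming (_≟_ to _≟ᵇ_)
open import Data.Nat using (ℕ; zero; suc; _+_; _≤_; _<_; z≤n; s≤s; s≤s⁻¹)
open import Data.Nat.Properties
  using ( _<?_; ≤-refl; ≤-trans; ≤-antisym; n≤1+n; <-≤-trans; <⇒≤; <⇒≱; ≤⇒≯; ≮⇒≥; ≰⇒>
        ; m≤n⇒m<n∨m≡n; n≤0⇒n≡0; suc-injective; 0≢1+n)
open import Data.Nat.DivMod using (_%_; %-distribˡ-+; %-remove-+ʳ)
open import Data.Nat.Divisibility using (_∣_; divides; ∣-trans; ∣1⇒≡1; n∣m⇒m%n≡0)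
open import Data.Integer using (+_; -_; -[1+_]; ∣_∣; _-_)
open import Data.Integer.Properties using ([1+m]⊖[1+n]≡m⊖n; ∣⊖∣-≤)
open import Data.Integer.Divisibility using () renaming (_∣_ to _∣ℤ_)
open import Data.Fin using (Fin; zero; suc; toℕ; inject₁)
open import Data.Fin.Properties using (toℕ-injective; toℕ-inject₁)
open import Data.Fin.Subset using (Subset; _∈_; _∉_; _∩_; inside) renaming (⊥ to ∅)
open import Data.Fin.Subset.Properties using (_∈?_; ∉⊥; p∩q⊆p; x∈p∩q⁺; x∈p∩q⁻)
open import Data.Vec using (_∷_; []; here; there)
open import Data.Empty using (⊥; ⊥-elim)
open import Data.Product using (∃; _×_; _,_; proj₁; proj₂)
open import Data.Sum using (inj₁; inj₂)
open import Relation.Binary.Definitions using (DecidableEquality)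
open import Relation.Binary.PropositionalEquality
open import Relation.Nullary using (¬_; Dec; yes; no; does; contradiction)
open import Relation.Nullary.Decidable using (dec-true; dec-false)

odd⇒4∤ : ∀ {n} → n % 2 ≡ 1 → ¬ 4 ∣ n
odd⇒4∤ {n} n-odd 4∣n = 0≢1+n (trans (sym (n∣m⇒m%n≡0 n 2 (∣-trans (divides 2 refl) 4∣n))) n-odd)

4∣1+n⇒n%4≢1 : ∀ {n} → 4 ∣ suc n → n % 4 ≢ 1
4∣1+n⇒n%4≢1 {n} 4∣1+n n%4≡1 = 0≢1+n (begin
  0                 ≡⟨ n∣m⇒m%n≡0 (suc n) 4 4∣1+n ⟨
  (1 + n) % 4       ≡⟨ %-distribˡ-+ 1 n 4 ⟩
  (1 + n % 4) % 4   ≡⟨ cong (λ r → (1 + r) % 4) n%4≡1 ⟩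
  2                 ∎)
  where open ≡-Reasoning

minVal≡1 : ∀ n → n % 4 ≡ 1 → minVal n ≡ + 1
minVal≡1 _ n%4≡1 rewrite n%4≡1 = refl

minVal≡-1 : ∀ n → n % 4 ≢ 1 → minVal n ≡ - + 1
minVal≡-1 n n%4≢1 with n % 4
... | 0           = refl
... | 1           = contradiction refl n%4≢1
... | suc (suc _) = refl

∣minVal∣≡1 : ∀ n → ∣ minVal n ∣ ≡ 1
∣minVal∣≡1 n with n % 4
... | 0           = refl
... | 1           = refl
... | suc (suc _) = refl

congruent-to-odd⇒nonzero : ∀ {n x} → n % 2 ≡ 1 → + 4 ∣ℤ x - + n → 0 < ∣ x ∣
congruent-to-odd⇒nonzero {suc n} {+ 0}      n-odd 4∣n = contradiction 4∣n (odd⇒4∤ n-odd)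
congruent-to-odd⇒nonzero {x = + suc _}      _     _   = s≤s z≤n
congruent-to-odd⇒nonzero {x = -[1+ _ ]}     _     _   = s≤s z≤n

unit-congruent⇒minimal : ∀ {n x} → ∣ x ∣ ≡ 1 → + 4 ∣ℤ x - + n → Minimal n x
unit-congruent⇒minimal {zero}  {+ 1}       _ 4∣1 = contradiction (∣1⇒≡1 4∣1) λ ()
unit-congruent⇒minimal {suc n} {+ 1}       _ 4∣n =
  sym (minVal≡1 (suc n) (%-remove-+ʳ 1 (subst (4 ∣_) ∣1-[1+n]∣≡n 4∣n)))
  where
  ∣1-[1+n]∣≡n : ∣ + 1 - + suc n ∣ ≡ n
  ∣1-[1+n]∣≡n = trans (cong ∣_∣ ([1+m]⊖[1+n]≡m⊖n 0 n)) (∣⊖∣-≤ z≤n)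
unit-congruent⇒minimal {zero}  { -[1+ 0 ]} _ _     = refl
unit-congruent⇒minimal {suc n} { -[1+ 0 ]} _ 4∣2+n = sym (minVal≡-1 (suc n) (4∣1+n⇒n%4≢1 4∣2+n))

initialSegment : ∀ {p} → ℕ → Subset p
initialSegment         zero    = ∅
initialSegment {zero}  (suc c) = []
initialSegment {suc p} (suc c) = inside ∷ initialSegment c

∈initialSegment⁺ : ∀ {p c} {x : Fin p} → toℕ x < c → x ∈ initialSegment c
∈initialSegment⁺ {x = zero}  (s≤s _)   = here
∈initialSegment⁺ {x = suc x} (s≤s x<c) = there (∈initialSegment⁺ x<c)

∈initialSegment⁻ : ∀ {p c} {x : Fin p} → x ∈ initialSegment c → toℕ x < c
∈initialSegment⁻ {c = zero}  x∈     = contradiction x∈ ∉⊥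
∈initialSegment⁻ {c = suc c} here    = s≤s z≤n
∈initialSegment⁻ {c = suc c} (there x∈) = s≤s (∈initialSegment⁻ x∈)

module LexOrderedCuts {p} (M : Matrix p) (M-sym : Symmetric M) (M-lex : LexOrdered M)
                      (M-nonzero : ∀ u v → 0 < ∣ M u v ∣) where

  UnitPrefix : Fin p → ℕ → Set
  UnitPrefix r b = ∀ t → toℕ t < b → ∣ M r t ∣ ≡ 1

  Cut : ℕ → Set
  Cut c = ∀ r → c ≤ toℕ r → UnitPrefix r c

  -- Row k cannot drop below row j inside the prefix, where row j already attains the minimum 1.
  unitPrefix-inherited : ∀ {j k b} → toℕ j < toℕ k → UnitPrefix j b → UnitPrefix k b
  unitPrefix-inherited {j} {k} {b} j<k unit-j t t<b with M-lex j k j<k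
  ... | inj₂ k≈j = trans (k≈j t) (unit-j t t<b)
  ... | inj₁ (q , k≈j-before-q , k<j-at-q) with toℕ q <? b
  ...   | yes q<b =
    contradiction (subst (∣ M k q ∣ <_) (unit-j q q<b) k<j-at-q) (≤⇒≯ (M-nonzero k q))
  ...   | no q≮b  = trans (k≈j-before-q t (<-≤-trans t<b (≮⇒≥ q≮b))) (unit-j t t<b)

  unitPrefix⇒cut : ∀ {x} → UnitPrefix x (toℕ x) → Cut (toℕ x)
  unitPrefix⇒cut {x} unit-x r x≤r with m≤n⇒m<n∨m≡n x≤r
  ... | inj₁ x<r = unitPrefix-inherited x<r unit-x
  ... | inj₂ x≡r = subst (λ r → UnitPrefix r (toℕ x)) (toℕ-injective x≡r) unit-x

  module Colouring {C : Set} (_≟ᶜ_ : DecidableEquality C) (colour : Fin p → C)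
                   (unit-across : ∀ u v → colour u ≢ colour v → ∣ M u v ∣ ≡ 1) where

    MonochromeFromCut : Fin p → Set
    MonochromeFromCut x =
      ∃ λ c → c ≤ toℕ x × Cut c × (∀ t → c ≤ toℕ t → toℕ t ≤ toℕ x → colour t ≡ colour x)

    monochromeFromCut-zero : ∀ {x} → toℕ x ≡ 0 → MonochromeFromCut x
    monochromeFromCut-zero {x} x≡0 = 0 , z≤n , (λ _ _ _ ()) , λ t _ t≤x →
      cong colour (toℕ-injective (trans (n≤0⇒n≡0 (subst (toℕ t ≤_) x≡0 t≤x)) (sym x≡0)))

    monochromeFromCut-suc : ∀ {x y} → toℕ x ≡ suc (toℕ y) → MonochromeFromCut y → MonochromeFromCut x
    monochromeFromCut-suc {x} {y} x≡1+y (c , c≤y , cut-c , mono-y) = extend (colour x ≟ᶜ colour y)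
      where
      ≤y : ∀ {t} → toℕ t < toℕ x → toℕ t ≤ toℕ y
      ≤y t<x = s≤s⁻¹ (subst (_ <_) x≡1+y t<x)

      c≤x : c ≤ toℕ x
      c≤x = ≤-trans c≤y (subst (toℕ y ≤_) (sym x≡1+y) (n≤1+n (toℕ y)))

      extend : Dec (colour x ≡ colour y) → MonochromeFromCut x
      extend (yes x~y) = c , c≤x , cut-c , mono-x
        where
        mono-x : ∀ t → c ≤ toℕ t → toℕ t ≤ toℕ x → colour t ≡ colour x
        mono-x t c≤t t≤x with m≤n⇒m<n∨m≡n t≤x
        ... | inj₁ t<x = trans (mono-y t c≤t (≤y t<x)) (sym x~y)
        ... | inj₂ t≡x = cong colour (toℕ-injective t≡x)
      extend (no x≁y) = toℕ x , ≤-refl , unitPrefix⇒cut unit-x , λ t x≤t t≤x →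
        cong colour (toℕ-injective (≤-antisym t≤x x≤t))
        where
        unit-x : UnitPrefix x (toℕ x)
        unit-x t t<x with toℕ t <? c
        ... | yes t<c = cut-c x c≤x t t<c
        ... | no t≮c  = unit-across x t λ x~t → x≁y (trans x~t (mono-y t (≮⇒≥ t≮c) (≤y t<x)))

    monochromeFromCut : ∀ x → MonochromeFromCut x
    monochromeFromCut x = go x refl
      where
      go : ∀ {m} x → toℕ x ≡ m → MonochromeFromCut x
      go {zero}  x       x≡0    = monochromeFromCut-zero x≡0
      go {suc m} (suc x) 1+x≡1+m =
        monochromeFromCut-suc (cong suc (sym (toℕ-inject₁ x)))
                              (go (inject₁ x) (trans (toℕ-inject₁ x) (suc-injective 1+x≡1+m)))

module OddCongruentMatrix {n p} (M : Matrix p) (M-sym : Symmetric M) (M-lex : LexOrdered M)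
                          (n-odd : n % 2 ≡ 1) (M≡n-mod4 : ∀ u v → + 4 ∣ℤ M u v - + n) where

  open LexOrderedCuts M M-sym M-lex
    (λ u v → congruent-to-odd⇒nonzero {n} {M u v} n-odd (M≡n-mod4 u v))

  minimal⇒unit : ∀ {x} → Minimal n x → ∣ x ∣ ≡ 1
  minimal⇒unit refl = ∣minVal∣≡1 n

  separated⇒unit-across : ∀ {A} → Separated n M A
                        → ∀ u v → does (u ∈? A) ≢ does (v ∈? A) → ∣ M u v ∣ ≡ 1
  separated⇒unit-across {A} A-sep u v u≁v with u ∈? A | v ∈? A
  ... | yes u∈A | no v∉A  = minimal⇒unit (A-sep u v u∈A v∉A)
  ... | no u∉A  | yes v∈A = trans (cong ∣_∣ (M-sym u v)) (minimal⇒unit (A-sep v u v∈A u∉A))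
  ... | yes _   | yes _   = contradiction refl u≁v
  ... | no _    | no _    = contradiction refl u≁v

  cut-cannot-split-block : ∀ {A c i k} → IsBlock n M A → Cut c
                         → i ∈ A → toℕ i < c → k ∈ A → c ≤ toℕ k → ⊥
  cut-cannot-split-block {A} {c} {i} {k} (_ , A-sep , A-minimal) cut i∈A i<c k∈A c≤k =
    A-minimal B (p∩q⊆p A _ , k , k∈A , k∉B) (i , x∈p∩q⁺ (i∈A , ∈initialSegment⁺ i<c)) B-sep
    where
    B : Subset p
    B = A ∩ initialSegment c

    k∉B : k ∉ B
    k∉B k∈B = <⇒≱ (∈initialSegment⁻ (proj₂ (x∈p∩q⁻ A _ k∈B))) c≤k

    B-sep : Separated n M B
    B-sep u v u∈B v∉B with x∈p∩q⁻ A _ u∈B | v ∈? A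
    ... | u∈A , _   | no v∉A  = A-sep u v u∈A v∉A
    ... | _   , u<c | yes v∈A = unit-congruent⇒minimal {n} {M u v}
          (trans (cong ∣_∣ (M-sym u v)) (cut v c≤v u (∈initialSegment⁻ u<c))) (M≡n-mod4 u v)
      where
      c≤v : c ≤ toℕ v
      c≤v = ≮⇒≥ λ v<c → v∉B (x∈p∩q⁺ (v∈A , ∈initialSegment⁺ v<c))

  module _ {A} (block : IsBlock n M A) where

    open Colouring _≟ᵇ_ (λ x → does (x ∈? A)) (separated⇒unit-across (proj₁ (proj₂ block)))

    block⇒contiguous : Contiguous A
    block⇒contiguous i j k i∈A k∈A i<j j<k with j ∈? A
    ... | yes j∈A = j∈A
    ... | no j∉A with monochromeFromCut j
    ...   | c , c≤j , cut , mono =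
      ⊥-elim (cut-cannot-split-block block cut i∈A i<c k∈A (≤-trans c≤j (<⇒≤ j<k)))
      where
      i<c : toℕ i < c
      i<c = ≰⇒> λ c≤i → contradiction
        (trans (sym (dec-true (i ∈? A) i∈A)) (trans (mono i c≤i (<⇒≤ i<j)) (dec-false (j ∈? A) j∉A)))
        λ ()

mainTheorem7 : (n p : ℕ) → n % 2 ≡ 1 → 1 ≤ p → (M : Matrix p)
    → InM n p M → LexOrdered M → BlockForm n M
mainTheorem7 n p n-odd _ M (M-sym , _ , _ , M≡n-mod4) M-lex A =
  OddCongruentMatrix.block⇒contiguous M M-sym M-lex n-odd M≡n-mod4
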